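{- Let $U$ be a set and $\lesssim$ a quasiorder on $U$. For $X\subseteq U$ let $X^{\blacktriangle}=\{x\in U\mid [x)\cap X\neq\emptyset\}$ and $X^{\blacktriangledown}=\{x\in U\mid [x)\subseteq X\}$, where $[x)=\{y\mid x\lesssim y\}$; call $X$ definable if $X^{\blacktriangledown}=X^{\blacktriangle}$. Then the definable subsets of $U$ are exactly the empty set and the unions of (nonempty families of) connected components of $\lesssim$.
   Context: A connected component of $\lesssim$ is an equivalence class of the smallest equivalence relation on $U$ containing $\lesssim$. -}

module Defs where

open import Level using (0ℓ)
open import Data.Product using (Σ; ∃; _×_; _,_)
open import Relation.Binary.Core using (Rel)
open import Relation.Unary using (Pred; _≐_; _⊆_; _∈_)
open import Relation.Binary.Construct.Closure.Equivalence using (EqClosure)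

module _ {U : Set} (_≲_ : Rel U 0ℓ) where

  ⟦_⟩ : U → Pred U 0ℓ
  ⟦ x ⟩ y = x ≲ y

  upper : Pred U 0ℓ → Pred U 0ℓ
  upper X x = ∃ λ y → (x ≲ y) × X y

  lower : Pred U 0ℓ → Pred U 0ℓ
  lower X x = ⟦ x ⟩ ⊆ X

  Definable : Pred U 0ℓ → Set
  Definable X = lower X ≐ upper X

  IsComponent : Pred U 0ℓ → Set
  IsComponent C = ∃ λ a → C ≐ EqClosure _≲_ a

  UnionOfComponents : Pred U 0ℓ → Set₁
  UnionOfComponents X =
    Σ Set λ I → Σ (I → Pred U 0ℓ) λ C →
      I × (∀ i → IsComponent (C i)) × (X ≐ (λ x → ∃ λ i → x ∈ C i))

{-# OPTIONS --safe #-}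
-- Both sides say that X is closed under the equivalence closure of ≲.
-- For definability this needs only reflexivity: x ∈ X gives x ∈ X▲ = X▼,
-- so X is closed upwards, and y ∈ X with x ≲ y gives x ∈ X▲ = X▼ ⊆ X, so
-- X is closed downwards. A nonempty closed set is the union of the
-- components of its elements; excluded middle decides whether X is empty.
module Submission where

open import Defs
open import Level using (0ℓ)
open import Data.Sum using (_⊎_; inj₁; inj₂; [_,_]′)
open import Data.Product using (_,_; proj₁)
open import Data.Empty using (⊥-elim)
open import Function using (id)
open import Function.Bundles using (_⇔_; mk⇔)
open import Function.Construct.Composition using (_⇔-∘_)
open import Relation.Binary.Core using (Rel)
open import Relation.Binary.Definitions using (Reflexive; _Respects_)
open import Relation.Binary.Structures using (IsPreorder)
open import Relation.Binary.PropositionalEquality using (_≡_)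
open import Relation.Unary using (Pred; Empty; Satisfiable)
open import Relation.Nullary using (yes; no)
open import Axiom.ExcludedMiddle using (ExcludedMiddle)
open import Relation.Binary.Construct.Closure.Equivalence using (EqClosure)
open import Relation.Binary.Construct.Closure.ReflexiveTransitive using (ε; _◅_; _◅◅_)
open import Relation.Binary.Construct.Closure.Symmetric using (fwd; bwd)

Empty⇒respects : ∀ {U : Set} {ℓ} {_∼_ : Rel U ℓ} {X : Pred U 0ℓ} → Empty X → X Respects _∼_
Empty⇒respects X-empty {x} _ x∈X = ⊥-elim (X-empty x x∈X)

module _ {U : Set} {R : Rel U 0ℓ} {X : Pred U 0ℓ} where

  UnionOfComponents⇒respects-EqClosure : UnionOfComponents R X → X Respects EqClosure R
  UnionOfComponents⇒respects-EqClosure (_ , C , _ , C-component , X⊆⋃C , ⋃C⊆X) x∼y x∈X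
    with X⊆⋃C x∈X
  ... | i , x∈Cᵢ with C-component i
  ...   | a , Cᵢ⊆[a] , [a]⊆Cᵢ = ⋃C⊆X (i , [a]⊆Cᵢ (Cᵢ⊆[a] x∈Cᵢ ◅◅ x∼y))

  respects-EqClosure⇒UnionOfComponents :
    Satisfiable X → X Respects EqClosure R → UnionOfComponents R X
  respects-EqClosure⇒UnionOfComponents X-inhabited resp =
    Satisfiable X , (λ a → EqClosure R (proj₁ a)) , X-inhabited ,
    (λ a → proj₁ a , id , id) ,
    (λ {x} x∈X → (x , x∈X) , ε) ,
    (λ { ((a , a∈X) , a∼x) → resp a∼x a∈X })

  respects-EqClosure⇔Empty⊎UnionOfComponents :
    ExcludedMiddle 0ℓ → X Respects EqClosure R ⇔ (Empty X ⊎ UnionOfComponents R X)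
  respects-EqClosure⇔Empty⊎UnionOfComponents lem = mk⇔ to
    [ Empty⇒respects , UnionOfComponents⇒respects-EqClosure ]′
    where
    to : X Respects EqClosure R → Empty X ⊎ UnionOfComponents R X
    to resp with lem {Satisfiable X}
    ... | yes X-inhabited = inj₂ (respects-EqClosure⇒UnionOfComponents X-inhabited resp)
    ... | no X-uninhabited = inj₁ (λ x x∈X → X-uninhabited (x , x∈X))

module _ {U : Set} {_≲_ : Rel U 0ℓ} (≲-refl : Reflexive _≲_) {X : Pred U 0ℓ} where

  Definable⇒respects-EqClosure : Definable _≲_ X → X Respects EqClosure _≲_
  Definable⇒respects-EqClosure (_ , upper⊆lower) = respects
    where
    respects : X Respects EqClosure _≲_
    respects ε = id
    respects (fwd x≲y ◅ y∼z) x∈X = respects y∼z (upper⊆lower (_ , ≲-refl , x∈X) x≲y)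
    respects (bwd y≲x ◅ y∼z) x∈X = respects y∼z (upper⊆lower (_ , y≲x , x∈X) ≲-refl)

  respects-EqClosure⇒Definable : X Respects EqClosure _≲_ → Definable _≲_ X
  respects-EqClosure⇒Definable resp =
    (λ {x} x∈lower → x , ≲-refl , x∈lower ≲-refl) ,
    (λ { (y , x≲y , y∈X) x≲z → resp (bwd x≲y ◅ fwd x≲z ◅ ε) y∈X })

  Definable⇔respects-EqClosure : Definable _≲_ X ⇔ X Respects EqClosure _≲_
  Definable⇔respects-EqClosure =
    mk⇔ Definable⇒respects-EqClosure respects-EqClosure⇒Definable

proposition4p16 : ExcludedMiddle 0ℓ → (U : Set) (_≲_ : Rel U 0ℓ) → IsPreorder _≡_ _≲_ →
    (X : Pred U 0ℓ) → Definable _≲_ X ⇔ (Empty X ⊎ UnionOfComponents _≲_ X)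
proposition4p16 lem U _≲_ ≲-preorder X =
  respects-EqClosure⇔Empty⊎UnionOfComponents lem
    ⇔-∘ Definable⇔respects-EqClosure (IsPreorder.refl ≲-preorder)
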